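{- Let $b$ and $b'$ be legal queue behaviors that are observationally equivalent, and let $\mu_b$ be a sequential witness for $b$. Then $b'$ has a sequential witness.
   Context: A queue event is a tuple $(u,m,d_{in},d_{out})$ with a globally unique identifier $u$ and method $m\in\{\mathtt{enq},\mathtt{deq}\}$; an enqueue event of value $x\in\mathbb{N}$ is written $\mathtt{enq}(x)$ and a dequeue event returning $x\in\mathbb{N}\cup\{\mathtt{NULL}\}$ is written $\mathtt{deq}(x)$. A queue behavior is a finite duplicate-free sequence of queue events. $\mathsf{LTS}_Q$ has states finite sequences over $\mathbb{N}$, initial state $\varepsilon$, and transitions $q\xrightarrow{\mathtt{enq}(x)}q\cdot x$, $x\cdot q'\xrightarrow{\mathtt{deq}(x)}q'$ ($x\in\mathbb{N}$), $\varepsilon\xrightarrow{\mathtt{deq}(\mathtt{NULL})}\varepsilon$; a behavior is legal if it is the label sequence of a run from $\varepsilon$. Two behaviors are observationally equivalent if their subsequences of enqueue events coincide and their subsequences of dequeue events coincide. For a behavior $b$: $\mathrm{Enq}(b)$, $\mathrm{Deq}(b)$ are its enqueue and dequeue events, $\mathrm{Val}(b,e)$ the value enqueued or returned by $e$, and $e\prec_b e'$ means $e$ occurs before $e'$ in $b$. A sequential witness for $b$ is a total map $\mu:\mathrm{Deq}(b)\to\mathrm{Enq}(b)\cup\{\bot\}$ such that: (i) $\mu(d)=e$ implies $\mathrm{Val}(b,d)=\mathrm{Val}(b,e)$; (ii) $\mu(d)=\bot$ iff $\mathrm{Val}(b,d)=\mathtt{NULL}$; (iii) $\mu(d)=\mu(d')\neq\bot$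 implies $d=d'$; (iv) $\mu(d)=e$ implies $e\prec_b d$; (v) if $e\prec_b\mu(d')$ then there is $d$ with $\mu(d)=e$ and $d\prec_b d'$; (vi) $\mu(d)=\bot$ implies $|\{e\in\mathrm{Enq}(b)\mid e\prec_b d\}|=|\{d'\in\mathrm{Deq}(b)\mid d'\prec_b d,\ \mu(d')\neq\bot\}|$. -}

module Defs where

open import Data.Nat using (ℕ; zero; suc; _+_; _<_)
open import Data.Maybe using (Maybe; just; nothing)
open import Data.List using (List; []; _∷_; _++_; [_]; map; length; lookup)
open import Data.List.Relation.Unary.Unique.Propositional using (Unique)
open import Data.Fin using (Fin; toℕ) renaming (zero to fzero; suc to fsuc)
open import Data.Bool using (Bool; true; false; not)
open import Data.Product using (Σ; _×_; ∃-syntax)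
open import Relation.Binary.PropositionalEquality using (_≡_; _≢_)
open import Relation.Nullary using (¬_)

-- Method together with its data: enq(x), or deq(r) with r = nothing standing for NULL.
data Op : Set where
  enq : ℕ → Op
  deq : Maybe ℕ → Op

-- A queue event (u, m, d_in, d_out): unique identifier plus method/data.
record Event : Set where
  constructor event
  field
    uid : ℕ
    op  : Op
open Event public

Behavior : Set
Behavior = List Event

DuplicateFree : Behavior → Set
DuplicateFree b = Unique (map uid b)

data Step : List ℕ → Op → List ℕ → Set where
  enqStep  : ∀ q x → Step q (enq x) (q ++ [ x ])
  deqStep  : ∀ x q → Step (x ∷ q) (deq (just x)) q
  nullStep : Step [] (deq nothing) []

data Run : List ℕ → List Op → Set where
  done : ∀ {q} → Run q []
  step : ∀ {q q' l ls} → Step q l q' → Run q' ls → Run q (l ∷ ls)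

Legal : Behavior → Set
Legal b = Run [] (map op b)

isEnqOp : Op → Bool
isEnqOp (enq _) = true
isEnqOp (deq _) = false

IsEnq IsDeq : Event → Set
IsEnq e = isEnqOp (op e) ≡ true
IsDeq e = isEnqOp (op e) ≡ false

enqs deqs : Behavior → Behavior
enqs [] = []
enqs (e ∷ b) with isEnqOp (op e)
... | true  = e ∷ enqs b
... | false = enqs b
deqs [] = []
deqs (e ∷ b) with isEnqOp (op e)
... | true  = deqs b
... | false = e ∷ deqs b

ObsEquiv : Behavior → Behavior → Set
ObsEquiv b b' = (enqs b ≡ enqs b') × (deqs b ≡ deqs b')

val : Event → Maybe ℕ
val e with op e
... | enq x = just x
... | deq r = r

countF : ∀ {n} → (Fin n → Bool) → ℕ
countF {zero} f = 0
countF {suc n} f with f fzero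
... | true  = suc (countF (λ i → f (fsuc i)))
... | false = countF (λ i → f (fsuc i))

_<ᵇF_ : ∀ {n} → Fin n → Fin n → Bool
i <ᵇF j = Data.Nat._<ᵇ_ (toℕ i) (toℕ j)

isJust : ∀ {A : Set} → Maybe A → Bool
isJust (just _) = true
isJust nothing  = false

_∧_ : Bool → Bool → Bool
true ∧ y = y
false ∧ _ = false

-- Events of b are referred to by their positions
-- (b is duplicate-free, so positions and events correspond bijectively;
-- e ≺_b e' is position order). μ is given on all positions but only its
-- restriction to dequeue positions matters; nothing stands for ⊥.
record SeqWitness (b : Behavior) : Set where
  field
    μ : Fin (length b) → Maybe (Fin (length b))
    μ-enq : ∀ d e → IsDeq (lookup b d) → μ d ≡ just e → IsEnq (lookup b e)
    w-i   : ∀ d e → IsDeq (lookup b d) → μ d ≡ just e → val (lookup b d) ≡ val (lookup b e)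
    w-ii₁ : ∀ d → IsDeq (lookup b d) → μ d ≡ nothing → val (lookup b d) ≡ nothing
    w-ii₂ : ∀ d → IsDeq (lookup b d) → val (lookup b d) ≡ nothing → μ d ≡ nothing
    w-iii : ∀ d d' e → IsDeq (lookup b d) → IsDeq (lookup b d') →
            μ d ≡ just e → μ d' ≡ just e → d ≡ d'
    w-iv  : ∀ d e → IsDeq (lookup b d) → μ d ≡ just e → toℕ e < toℕ d
    w-v   : ∀ e d' e' → IsEnq (lookup b e) → IsDeq (lookup b d') → μ d' ≡ just e' →
            toℕ e < toℕ e' →
            ∃[ d ] (IsDeq (lookup b d) × μ d ≡ just e × toℕ d < toℕ d')
    w-vi  : ∀ d → IsDeq (lookup b d) → μ d ≡ nothing →
            countF (λ e → isEnqOp (op (lookup b e)) ∧ (e <ᵇF d))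
              ≡ countF (λ d' → (not (isEnqOp (op (lookup b d'))) ∧ isJust (μ d'))
                              ∧ (d' <ᵇF d))

-- Every legal behavior has a canonical sequential witness: the k-th dequeue that
-- returns a value is matched with the k-th enqueue. Since LTS_Q is FIFO, the value
-- returned by that dequeue is the one enqueued by that enqueue, and a dequeue
-- returns NULL exactly when the queue is empty, i.e. when the enqueues before it
-- are as many as the value-returning dequeues before it. So legality of b' alone
-- yields its witness.
module Submission where

open import Defs
open import Data.Nat using (ℕ; zero; suc; _+_; _<_; z≤n; s≤s; _<ᵇ_)
open import Data.Nat.Properties using (+-assoc)
open import Data.Maybe using (Maybe; just; nothing)
import Data.Maybe as Maybe
open import Data.Maybe.Properties using (just-injective)
open import Data.List using (List; []; _∷_; _++_; [_]; map; length; lookup)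
open import Data.List.Properties using (length-++; ++-assoc)
open import Data.Fin using (Fin; toℕ) renaming (zero to fzero; suc to fsuc)
open import Data.Bool using (Bool; true; false; not; if_then_else_)
open import Data.Product using (_×_; _,_; ∃-syntax; proj₁; proj₂)
open import Relation.Binary.PropositionalEquality
  using (_≡_; refl; sym; trans; cong; subst; module ≡-Reasoning)

private
  variable
    A : Set

countPrefix : (A → Bool) → List A → ℕ → ℕ
countPrefix P xs       zero    = 0
countPrefix P []       (suc k) = 0
countPrefix P (x ∷ xs) (suc k) = if P x then suc (countPrefix P xs k) else countPrefix P xs k

-- 0-based: nthIndex P xs 0 is the position of the first element satisfying P.
nthIndex : (A → Bool) → (xs : List A) → ℕ → Maybe (Fin (length xs))
nthIndex P []       k       = nothing
nthIndex P (x ∷ xs) k with P x | k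
... | true  | zero   = just fzero
... | true  | suc k′ = Maybe.map fsuc (nthIndex P xs k′)
... | false | k′     = Maybe.map fsuc (nthIndex P xs k′)

fsuc-preimage : ∀ {n} (m : Maybe (Fin n)) {i : Fin (suc n)} → Maybe.map fsuc m ≡ just i →
  ∃[ j ] (m ≡ just j × i ≡ fsuc j)
fsuc-preimage (just j) refl = j , refl , refl

nthIndex-sound : (P : A → Bool) (xs : List A) (k : ℕ) {i : Fin (length xs)} →
  nthIndex P xs k ≡ just i → P (lookup xs i) ≡ true × countPrefix P xs (toℕ i) ≡ k
nthIndex-sound P (x ∷ xs) k h with P x in px | k | h
... | true  | zero   | refl = px , refl
... | true  | suc k′ | h′ with j , hj , refl ← fsuc-preimage (nthIndex P xs k′) h′
  with Pj , cj ← nthIndex-sound P xs k′ hj rewrite px = Pj , cong suc cj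
... | false | k′     | h′ with j , hj , refl ← fsuc-preimage (nthIndex P xs k′) h′
  rewrite px = nthIndex-sound P xs k′ hj

nthIndex-countPrefix : (P : A → Bool) (xs : List A) (i : Fin (length xs)) →
  P (lookup xs i) ≡ true → nthIndex P xs (countPrefix P xs (toℕ i)) ≡ just i
nthIndex-countPrefix P (x ∷ xs) fzero h rewrite h = refl
nthIndex-countPrefix P (x ∷ xs) (fsuc i) h with P x
... | true  rewrite nthIndex-countPrefix P xs i h = refl
... | false rewrite nthIndex-countPrefix P xs i h = refl

nthIndex-below : (P : A → Bool) (xs : List A) (k j : ℕ) → k < countPrefix P xs j →
  ∃[ i ] (nthIndex P xs k ≡ just i × toℕ i < j)
nthIndex-below P (x ∷ xs) k (suc j) h with P x | k | h
... | true  | zero   | _       = fzero , refl , s≤s z≤n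
... | true  | suc k′ | s≤s h′ with i , hi , i<j ← nthIndex-below P xs k′ j h′
  rewrite hi = fsuc i , refl , s≤s i<j
... | false | k′     | h′     with i , hi , i<j ← nthIndex-below P xs k′ j h′
  rewrite hi = fsuc i , refl , s≤s i<j

countPrefix-< : (P : A → Bool) (xs : List A) (i : Fin (length xs)) (k : ℕ) →
  P (lookup xs i) ≡ true → toℕ i < k → countPrefix P xs (toℕ i) < countPrefix P xs k
countPrefix-< P (x ∷ xs) fzero    (suc k) h _ rewrite h = s≤s z≤n
countPrefix-< P (x ∷ xs) (fsuc i) (suc k) h (s≤s i<k) with P x
... | true  = s≤s (countPrefix-< P xs i k h i<k)
... | false = countPrefix-< P xs i k h i<k

countF-countPrefix : (P : A → Bool) (xs : List A) (k : ℕ) (f : Fin (length xs) → Bool) →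
  (∀ i → f i ≡ (P (lookup xs i) ∧ (toℕ i <ᵇ k))) → countF f ≡ countPrefix P xs k
countF-countPrefix P []       zero    f h = refl
countF-countPrefix P []       (suc k) f h = refl
countF-countPrefix P (x ∷ xs) zero    f h with f fzero | P x | h fzero
... | false | _     | _  = countF-countPrefix P xs zero (λ i → f (fsuc i)) (λ i → h (fsuc i))
... | true  | true  | ()
... | true  | false | ()
countF-countPrefix P (x ∷ xs) (suc k) f h with f fzero | P x | h fzero
... | true  | true  | _  = cong suc (countF-countPrefix P xs k (λ i → f (fsuc i)) (λ i → h (fsuc i)))
... | false | false | _  = countF-countPrefix P xs k (λ i → f (fsuc i)) (λ i → h (fsuc i))
... | true  | false | ()
... | false | true  | ()

countPrefix-injective : (P : A → Bool) (xs : List A) (i j : Fin (length xs)) →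
  P (lookup xs i) ≡ true → P (lookup xs j) ≡ true →
  countPrefix P xs (toℕ i) ≡ countPrefix P xs (toℕ j) → i ≡ j
countPrefix-injective P xs i j Pi Pj ci≡cj = just-injective (begin
  just i                                   ≡⟨ nthIndex-countPrefix P xs i Pi ⟨
  nthIndex P xs (countPrefix P xs (toℕ i)) ≡⟨ cong (nthIndex P xs) ci≡cj ⟩
  nthIndex P xs (countPrefix P xs (toℕ j)) ≡⟨ nthIndex-countPrefix P xs j Pj ⟩
  just j                                   ∎)
  where open ≡-Reasoning

_!?_ : List A → ℕ → Maybe A
[]       !? k     = nothing
(x ∷ xs) !? zero  = just x
(x ∷ xs) !? suc k = xs !? k

if-then-nothing : ∀ {c : Bool} {m : Maybe A} {a : A} →
  (if c then m else nothing) ≡ just a → c ≡ true × m ≡ just a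
if-then-nothing {c = true} h = refl , h

∧-falseʳ : ∀ c → (c ∧ false) ≡ false
∧-falseʳ true  = refl
∧-falseʳ false = refl

isEnqᵇ returnsValue : Event → Bool
isEnqᵇ e = isEnqOp (op e)
returnsValue (event _ (deq (just _))) = true
returnsValue _                        = false

returnsValue-true : ∀ e → returnsValue e ≡ true → ∃[ x ] (op e ≡ deq (just x))
returnsValue-true (event _ (deq (just x))) _ = x , refl

returnsValue-false : ∀ e → IsDeq e → returnsValue e ≡ false → op e ≡ deq nothing
returnsValue-false (event _ (deq nothing)) _ _ = refl

val-nothing : ∀ e → val e ≡ nothing → returnsValue e ≡ false
val-nothing (event _ (deq nothing)) _ = refl

val-deq : ∀ e {r} → op e ≡ deq r → val e ≡ r
val-deq (event _ _) refl = refl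

enqueuedValues : Behavior → ℕ → List ℕ
enqueuedValues b                      zero    = []
enqueuedValues []                     (suc k) = []
enqueuedValues (event _ (enq x) ∷ b) (suc k) = x ∷ enqueuedValues b k
enqueuedValues (event _ (deq _) ∷ b) (suc k) = enqueuedValues b k

-- The queue just before step d is q ++ enqueuedValues b d with its first
-- countPrefix returnsValue b d entries removed.
dequeue-fifo : ∀ {q} (b : Behavior) → Run q (map op b) → (d : Fin (length b)) {x : ℕ} →
  op (lookup b d) ≡ deq (just x) →
  (q ++ enqueuedValues b (toℕ d)) !? countPrefix returnsValue b (toℕ d) ≡ just x
dequeue-fifo (event _ (deq (just _)) ∷ b) (step (deqStep _ _) r) fzero refl = refl
dequeue-fifo {q} (event _ (enq y) ∷ b) (step (enqStep _ _) r) (fsuc d) h =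
  subst (λ xs → xs !? countPrefix returnsValue b (toℕ d) ≡ just _)
    (++-assoc q [ y ] (enqueuedValues b (toℕ d))) (dequeue-fifo b r d h)
dequeue-fifo (event _ (deq (just _)) ∷ b) (step (deqStep _ _) r) (fsuc d) h = dequeue-fifo b r d h
dequeue-fifo (event _ (deq nothing) ∷ b)  (step nullStep r)       (fsuc d) h = dequeue-fifo b r d h

nullDequeue-balance : ∀ {q} (b : Behavior) → Run q (map op b) → (d : Fin (length b)) →
  op (lookup b d) ≡ deq nothing →
  length q + countPrefix isEnqᵇ b (toℕ d) ≡ countPrefix returnsValue b (toℕ d)
nullDequeue-balance (event _ (deq nothing) ∷ b) (step nullStep r) fzero refl = refl
nullDequeue-balance {q} (event _ (enq y) ∷ b) (step (enqStep _ _) r) (fsuc d) h = begin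
  length q + suc (countPrefix isEnqᵇ b (toℕ d))       ≡⟨ +-assoc (length q) 1 _ ⟨
  (length q + 1) + countPrefix isEnqᵇ b (toℕ d)       ≡⟨ cong (_+ _) (length-++ q) ⟨
  length (q ++ [ y ]) + countPrefix isEnqᵇ b (toℕ d)  ≡⟨ nullDequeue-balance b r d h ⟩
  countPrefix returnsValue b (toℕ d)                  ∎
  where open ≡-Reasoning
nullDequeue-balance (event _ (deq (just _)) ∷ b) (step (deqStep _ _) r) (fsuc d) h =
  cong suc (nullDequeue-balance b r d h)
nullDequeue-balance (event _ (deq nothing) ∷ b) (step nullStep r) (fsuc d) h =
  nullDequeue-balance b r d h

enqueuedValues-!? : (b : Behavior) (k n : ℕ) {x : ℕ} → enqueuedValues b k !? n ≡ just x →
  ∃[ e ] (nthIndex isEnqᵇ b n ≡ just e × toℕ e < k × val (lookup b e) ≡ just x)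
enqueuedValues-!? (event _ (enq y) ∷ b) (suc k) zero    refl = fzero , refl , s≤s z≤n , refl
enqueuedValues-!? (event _ (enq y) ∷ b) (suc k) (suc n) h
  with e , he , e<k , ve ← enqueuedValues-!? b k n h rewrite he = fsuc e , refl , s≤s e<k , ve
enqueuedValues-!? (event _ (deq r) ∷ b) (suc k) n h
  with e , he , e<k , ve ← enqueuedValues-!? b k n h rewrite he = fsuc e , refl , s≤s e<k , ve

module _ (b : Behavior) (legal : Legal b) where

  matchedEnq : Fin (length b) → Maybe (Fin (length b))
  matchedEnq d = nthIndex isEnqᵇ b (countPrefix returnsValue b (toℕ d))

  fifoMatch : Fin (length b) → Maybe (Fin (length b))
  fifoMatch d = if returnsValue (lookup b d) then matchedEnq d else nothing

  matchedEnq-returnsValue : ∀ d {x} → op (lookup b d) ≡ deq (just x) →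
    ∃[ e ] (matchedEnq d ≡ just e × toℕ e < toℕ d × val (lookup b e) ≡ just x)
  matchedEnq-returnsValue d opd = enqueuedValues-!? b (toℕ d) _ (dequeue-fifo b legal d opd)

  fifoMatch-just : ∀ d {e} → fifoMatch d ≡ just e →
    returnsValue (lookup b d) ≡ true × matchedEnq d ≡ just e ×
    toℕ e < toℕ d × val (lookup b d) ≡ val (lookup b e)
  fifoMatch-just d h with returns , matched ← if-then-nothing h
    with _ , opd ← returnsValue-true (lookup b d) returns
    with e′ , matched′ , e′<d , ve′ ← matchedEnq-returnsValue d opd
    with refl ← trans (sym matched′) matched =
      returns , matched , e′<d , trans (val-deq (lookup b d) opd) (sym ve′)

  fifoMatch-nothing : ∀ d → IsDeq (lookup b d) → fifoMatch d ≡ nothing →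
    op (lookup b d) ≡ deq nothing
  fifoMatch-nothing d isDeq h with returnsValue (lookup b d) in returns
  ... | false = returnsValue-false (lookup b d) isDeq returns
  ... | true with _ , opd ← returnsValue-true (lookup b d) returns
    with _ , matched , _ ← matchedEnq-returnsValue d opd with () ← trans (sym h) matched

  isJust-fifoMatch : ∀ d → (not (isEnqOp (op (lookup b d))) ∧ isJust (fifoMatch d))
                           ≡ returnsValue (lookup b d)
  isJust-fifoMatch d with returnsValue (lookup b d) in returns
  ... | false = ∧-falseʳ _
  ... | true with _ , opd ← returnsValue-true (lookup b d) returns
    with _ , matched , _ ← matchedEnq-returnsValue d opd rewrite opd | matched = refl

  fifoMatch-fifo : ∀ e d′ e′ → IsEnq (lookup b e) → fifoMatch d′ ≡ just e′ → toℕ e < toℕ e′ →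
    ∃[ d ] (IsDeq (lookup b d) × fifoMatch d ≡ just e × toℕ d < toℕ d′)
  fifoMatch-fifo e d′ e′ isEnq h e<e′
    with _ , matched , _ ← fifoMatch-just d′ h
    with _ , count-e′ ← nthIndex-sound isEnqᵇ b _ matched
    with d , found , d<d′ ← nthIndex-below returnsValue b (countPrefix isEnqᵇ b (toℕ e)) (toℕ d′)
           (subst (_ <_) count-e′ (countPrefix-< isEnqᵇ b e (toℕ e′) isEnq e<e′))
    with returns , count-d ← nthIndex-sound returnsValue b _ found
    with _ , opd ← returnsValue-true (lookup b d) returns
    = d , isDeq , matchedE , d<d′
    where
    open ≡-Reasoning
    matchedE : fifoMatch d ≡ just e
    matchedE = begin
      fifoMatch d
        ≡⟨ cong (if_then matchedEnq d else nothing) returns ⟩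
      matchedEnq d
        ≡⟨ cong (nthIndex isEnqᵇ b) count-d ⟩
      nthIndex isEnqᵇ b (countPrefix isEnqᵇ b (toℕ e))
        ≡⟨ nthIndex-countPrefix isEnqᵇ b e isEnq ⟩
      just e ∎
    isDeq : IsDeq (lookup b d)
    isDeq rewrite opd = refl

  fifoMatch-injective : ∀ d d′ {e} → fifoMatch d ≡ just e → fifoMatch d′ ≡ just e → d ≡ d′
  fifoMatch-injective d d′ h h′
    with returns , matched , _ ← fifoMatch-just d h
    with returns′ , matched′ , _ ← fifoMatch-just d′ h′ =
      countPrefix-injective returnsValue b d d′ returns returns′
        (trans (sym (count d matched)) (count d′ matched′))
    where
    count : ∀ d {e} → matchedEnq d ≡ just e →
            countPrefix isEnqᵇ b (toℕ e) ≡ countPrefix returnsValue b (toℕ d)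
    count _ matched = proj₂ (nthIndex-sound isEnqᵇ b _ matched)

  nullDequeue-counts : ∀ d → IsDeq (lookup b d) → fifoMatch d ≡ nothing →
    countF (λ e → isEnqOp (op (lookup b e)) ∧ (e <ᵇF d))
      ≡ countF (λ d′ → (not (isEnqOp (op (lookup b d′))) ∧ isJust (fifoMatch d′)) ∧ (d′ <ᵇF d))
  nullDequeue-counts d isDeq h = begin
    countF (λ e → isEnqOp (op (lookup b e)) ∧ (e <ᵇF d))
      ≡⟨ countF-countPrefix isEnqᵇ b (toℕ d) _ (λ _ → refl) ⟩
    countPrefix isEnqᵇ b (toℕ d)
      ≡⟨ nullDequeue-balance b legal d (fifoMatch-nothing d isDeq h) ⟩
    countPrefix returnsValue b (toℕ d)
      ≡⟨ countF-countPrefix returnsValue b (toℕ d) _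
           (λ i → cong (_∧ (i <ᵇF d)) (isJust-fifoMatch i)) ⟨
    countF (λ d′ → (not (isEnqOp (op (lookup b d′))) ∧ isJust (fifoMatch d′)) ∧ (d′ <ᵇF d)) ∎
    where open ≡-Reasoning

  legal⇒SeqWitness : SeqWitness b
  legal⇒SeqWitness = record
    { μ     = fifoMatch
    ; μ-enq = λ d e _ h → let _ , matched , _ = fifoMatch-just d h in
                          proj₁ (nthIndex-sound isEnqᵇ b _ matched)
    ; w-i   = λ d e _ h → let _ , _ , _ , v = fifoMatch-just d h in v
    ; w-ii₁ = λ d isDeq h → val-deq (lookup b d) (fifoMatch-nothing d isDeq h)
    ; w-ii₂ = λ d _ v → cong (if_then matchedEnq d else nothing) (val-nothing (lookup b d) v)
    ; w-iii = λ d d′ e _ _ → fifoMatch-injective d d′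
    ; w-iv  = λ d e _ h → let _ , _ , e<d , _ = fifoMatch-just d h in e<d
    ; w-v   = λ e d′ e′ isEnq _ → fifoMatch-fifo e d′ e′ isEnq
    ; w-vi  = nullDequeue-counts
    }

lemma3p6 : (b b' : Behavior) → DuplicateFree b → DuplicateFree b' →
    Legal b → Legal b' → ObsEquiv b b' → SeqWitness b → SeqWitness b'
lemma3p6 _ b' _ _ _ legal' _ _ = legal⇒SeqWitness b' legal'
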